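{- Every union-free family of non-empty subsets of $\{1,2,3,4\}$ has at most $7$ members.
   Context: A family of sets is union-free if no member equals the union of one or more other members of the family. -}

module Defs where

open import Data.Nat using (ℕ)
open import Data.List using (List; [])
open import Data.List.Membership.Propositional using (_∈_)
open import Data.List.Relation.Unary.All using (All)
open import Data.Product using (_×_)
open import Data.Fin.Subset using (Subset; ⋃)
open import Relation.Binary.PropositionalEquality using (_≡_; _≢_)
open import Relation.Nullary using (¬_)

-- A family 𝓕 of subsets of an n-element ground set, given as a list
-- (distinctness of members is imposed separately via Unique).
UnionFree : {n : ℕ} → List (Subset n) → Set
UnionFree {n} 𝓕 =
  ∀ (F : Subset n) → F ∈ 𝓕 →
  ∀ (𝓖 : List (Subset n)) → 𝓖 ≢ [] →
  All (λ G → G ∈ 𝓕 × G ≢ F) 𝓖 →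
  ⋃ 𝓖 ≢ F

-- A member p of a union-free family of non-empty sets is not the union of the
-- members properly contained in it: if there are none, that union is ∅ ≠ p, and
-- otherwise p would be a union of other members. So if the 16 subsets of
-- {1,2,3,4} are scanned in an order extending inclusion, every member of the
-- family is, when reached, not covered by the members chosen before it; an
-- exhaustive search over such selections finds none with more than 7 sets.
module Submission where

open import Defs
open import Data.Bool using (if_then_else_)
open import Data.Bool.Properties using () renaming (_≟_ to _≟ᵇ_)
open import Data.Empty using (⊥-elim)
open import Data.Fin.Subset using (Subset; Nonempty; ⋃; inside; outside)
  renaming (_∈_ to _∈ₛ_)
open import Data.Fin.Subset.Properties using (_⊂?_; ⊂-irref; ∉⊥)
open import Data.List using (List; []; _∷_; [_]; length; map; filter; _++_)
import Data.List.Membership.DecPropositional as DecMembership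
open import Data.List.Membership.Propositional using (_∈_)
open import Data.List.Membership.Propositional.Properties
  using (∈-∃++; ∈-++⁻; ∈-++⁺ˡ; ∈-++⁺ʳ; ∈-map⁺; ∈-filter⁺; ∈-filter⁻)
open import Data.List.Properties using (length-++-sucʳ)
open import Data.List.Relation.Binary.Subset.Propositional using (_⊆_)
open import Data.List.Relation.Binary.Subset.Propositional.Properties using (∈-∷⁺ʳ)
open import Data.List.Relation.Unary.All as All using (All)
open import Data.List.Relation.Unary.Any using (here; there)
open import Data.List.Relation.Unary.AllPairs using (_∷_)
open import Data.List.Relation.Unary.Unique.Propositional using (Unique)
open import Data.Nat using (ℕ; zero; suc; _≤_; _⊔_; z≤n; s≤s)
open import Data.Nat.Properties using (≤-trans; ≤-reflexive; m≤m⊔n; m≤n⊔m; module ≤-Reasoning)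
open import Data.Product using (_×_; _,_)
open import Data.Sum using (inj₁; inj₂)
open import Data.Vec using ([]; _∷_)
open import Data.Vec.Properties using (≡-dec)
open import Relation.Binary.Definitions using (DecidableEquality)
open import Relation.Binary.PropositionalEquality using (_≡_; _≢_; refl; sym; subst)
open import Relation.Nullary using (¬_; Dec; does; yes; no)

unique-⊆⇒length≤ : {A : Set} {xs ys : List A} → Unique xs → xs ⊆ ys → length xs ≤ length ys
unique-⊆⇒length≤ {xs = []} _ _ = z≤n
unique-⊆⇒length≤ {xs = x ∷ xs} (x∉xs ∷ !xs) xs⊆ys with ∈-∃++ (xs⊆ys (here refl))
... | us , vs , refl =
  ≤-trans (s≤s (unique-⊆⇒length≤ !xs xs⊆us++vs)) (≤-reflexive (sym (length-++-sucʳ us x vs)))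
  where
  xs⊆us++vs : xs ⊆ us ++ vs
  xs⊆us++vs z∈xs with ∈-++⁻ us (xs⊆ys (there z∈xs))
  ... | inj₁ z∈us = ∈-++⁺ˡ z∈us
  ... | inj₂ (here refl) = ⊥-elim (All.lookup x∉xs z∈xs refl)
  ... | inj₂ (there z∈vs) = ∈-++⁺ʳ us z∈vs

-- Binary counting, first coordinate most significant: a proper subset comes
-- before its supersets, which is what lets the search below prune enough.
subsets : ∀ n → List (Subset n)
subsets zero = [ [] ]
subsets (suc n) = map (outside ∷_) (subsets n) ++ map (inside ∷_) (subsets n)

∈-subsets : ∀ {n} (p : Subset n) → p ∈ subsets n
∈-subsets [] = here refl
∈-subsets (outside ∷ p) = ∈-++⁺ˡ (∈-map⁺ (outside ∷_) (∈-subsets p))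
∈-subsets (inside ∷ p) = ∈-++⁺ʳ (map (outside ∷_) (subsets _)) (∈-map⁺ (inside ∷_) (∈-subsets p))

_≟ₛ_ : ∀ {n} → DecidableEquality (Subset n)
_≟ₛ_ = ≡-dec _≟ᵇ_

Covered : ∀ {n} → List (Subset n) → Subset n → Set
Covered chosen p = ⋃ (filter (_⊂? p) chosen) ≡ p

covered? : ∀ {n} (chosen : List (Subset n)) (p : Subset n) → Dec (Covered chosen p)
covered? chosen p = ⋃ (filter (_⊂? p) chosen) ≟ₛ p

longestUncoveredSelection : ∀ {n} → List (Subset n) → List (Subset n) → ℕ
longestUncoveredSelection chosen [] = 0
longestUncoveredSelection chosen (p ∷ rest) =
  longestUncoveredSelection chosen rest ⊔
    (if does (covered? chosen p) then 0 else suc (longestUncoveredSelection (p ∷ chosen) rest))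

module _ {n} {𝓕 : List (Subset n)} (nonempty : All Nonempty 𝓕) (unionFree : UnionFree 𝓕) where

  ⋃-others≢member : ∀ {p} → p ∈ 𝓕 → (𝓖 : List (Subset n)) →
    All (λ G → G ∈ 𝓕 × G ≢ p) 𝓖 → ⋃ 𝓖 ≢ p
  ⋃-others≢member p∈𝓕 [] _ ⊥≡p with All.lookup nonempty p∈𝓕
  ... | x , x∈p = ∉⊥ (subst (x ∈ₛ_) (sym ⊥≡p) x∈p)
  ⋃-others≢member p∈𝓕 (G ∷ 𝓖) others = unionFree _ p∈𝓕 (G ∷ 𝓖) (λ ()) others

  ∈⇒¬Covered : ∀ {p chosen} → chosen ⊆ 𝓕 → p ∈ 𝓕 → ¬ Covered chosen p
  ∈⇒¬Covered {p} {chosen} chosen⊆𝓕 p∈𝓕 = ⋃-others≢member p∈𝓕 _ (All.tabulate other)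
    where
    other : ∀ {q} → q ∈ filter (_⊂? p) chosen → q ∈ 𝓕 × q ≢ p
    other q∈ with ∈-filter⁻ (_⊂? p) q∈
    ... | q∈chosen , q⊂p = chosen⊆𝓕 q∈chosen , λ q≡p → ⊂-irref q≡p q⊂p

  open DecMembership (_≟ₛ_ {n}) using (_∈?_)

  members≤longestUncoveredSelection : ∀ {chosen} → chosen ⊆ 𝓕 →
    ∀ rest → length (filter (_∈? 𝓕) rest) ≤ longestUncoveredSelection chosen rest
  members≤longestUncoveredSelection chosen⊆𝓕 [] = z≤n
  members≤longestUncoveredSelection {chosen} chosen⊆𝓕 (p ∷ rest) with p ∈? 𝓕
  ... | no _ = ≤-trans (members≤longestUncoveredSelection chosen⊆𝓕 rest) (m≤m⊔n _ _)
  ... | yes p∈𝓕 with covered? chosen p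
  ...   | yes covered = ⊥-elim (∈⇒¬Covered chosen⊆𝓕 p∈𝓕 covered)
  ...   | no _ = ≤-trans (s≤s (members≤longestUncoveredSelection (∈-∷⁺ʳ p∈𝓕 chosen⊆𝓕) rest))
                         (m≤n⊔m _ _)

longestUncoveredSelection-subsets-4 : longestUncoveredSelection [] (subsets 4) ≡ 7
longestUncoveredSelection-subsets-4 = refl

mainTheorem9 : (𝓕 : List (Subset 4)) → Unique 𝓕 → All Nonempty 𝓕 →
    UnionFree 𝓕 → length 𝓕 ≤ 7
mainTheorem9 𝓕 unique nonempty unionFree = begin
  length 𝓕                                 ≤⟨ unique-⊆⇒length≤ unique 𝓕⊆members ⟩
  length (filter (_∈? 𝓕) (subsets 4))       ≤⟨ members≤longestUncoveredSelection
                                                 nonempty unionFree {[]} (λ ()) (subsets 4) ⟩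
  longestUncoveredSelection [] (subsets 4) ≡⟨ longestUncoveredSelection-subsets-4 ⟩
  7                                        ∎
  where
  open ≤-Reasoning
  open DecMembership _≟ₛ_ using (_∈?_)
  𝓕⊆members : 𝓕 ⊆ filter (_∈? 𝓕) (subsets 4)
  𝓕⊆members {p} p∈𝓕 = ∈-filter⁺ (_∈? 𝓕) (∈-subsets p) p∈𝓕
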